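{- Let $G$ be an $n$-vertex graph. If $Z(G) \leq n-k$, then $G$ contains a $k$-witness. Moreover, if $G$ contains a $k$-witness $(\mathbf{s},\mathbf{t})$ with $\{s_1,\dots,s_k\}\cap\{t_1,\dots,t_k\}=\emptyset$, then $Z(G)\leq n-k$.
   Context: In a graph $G$ with vertex set $V$, a $k$-witness is a pair of ordered $k$-tuples $\mathbf{s}=(s_i)_{i\in[k]}$, $\mathbf{t}=(t_i)_{i\in[k]}$ of vertices with $s_i\neq s_j$ for $i\neq j$, such that $s_i$ is adjacent to $t_i$ for every $i$, and $s_i$ is not adjacent to $t_j$ for all $i<j$ (it is allowed that $s_i=t_j$ for some $i>j$). Zero forcing process: initially a set $S$ of vertices is black, all others white; at each step, a black vertex with exactly one white neighbour forces that neighbour to become black. $S$ is a zero forcing set if eventually all vertices become black. $Z(G)$ is the minimum cardinality of a zero forcing set. -}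

module Defs where

open import Data.Nat using (ℕ; _<_; _≤_)
open import Data.Fin using (Fin; toℕ)
open import Data.Fin.Subset using (Subset; _∈_; _∉_; _∪_; ⁅_⁆; ⊤; ∣_∣)
open import Data.Product using (Σ; ∃; _×_; _,_)
open import Relation.Binary.PropositionalEquality using (_≡_; _≢_)
open import Relation.Binary.Construct.Closure.ReflexiveTransitive using (Star)
open import Relation.Nullary using (¬_)
open import Function.Definitions using (Injective)

record Graph (n : ℕ) : Set₁ where
  field
    Adj    : Fin n → Fin n → Set
    sym    : ∀ {u v} → Adj u v → Adj v u
    irrefl : ∀ {u} → ¬ Adj u u
open Graph public

data ForceStep {n : ℕ} (G : Graph n) (B : Subset n) : Subset n → Set where
  force : (u v : Fin n) → u ∈ B → Adj G u v → v ∉ B →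
          (∀ w → Adj G u w → w ∉ B → w ≡ v) →
          ForceStep G B (B ∪ ⁅ v ⁆)

ZeroForcingSet : ∀ {n} → Graph n → Subset n → Set
ZeroForcingSet G S = Star (ForceStep G) S ⊤

IsWitness : ∀ {n} (G : Graph n) (k : ℕ) → (Fin k → Fin n) → (Fin k → Fin n) → Set
IsWitness G k s t =
  Injective _≡_ _≡_ s ×
  (∀ i → Adj G (s i) (t i)) ×
  (∀ i j → toℕ i < toℕ j → ¬ Adj G (s i) (t j))

HasWitness : ∀ {n} → Graph n → ℕ → Set
HasWitness {n} G k = Σ (Fin k → Fin n) λ s → Σ (Fin k → Fin n) λ t → IsWitness G k s t

-- Reading a zero forcing sequence forwards, the i-th forcing vertex s_i is adjacent to the
-- vertex t_i it forces, and not to any later t_j, which is still white at step i and so is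
-- not the unique white neighbour of s_i: the n − |S| forces form an (n − |S|)-witness, and
-- any prefix of a witness is a witness. Conversely, starting from the complement of
-- {t_1, …, t_k}, the vertex s_i is black (s and t are disjoint) and its only white
-- neighbour is t_i, so s_1, …, s_k force t_1, …, t_k in this order.
module Submission where

open import Defs hiding (sym)
open import Data.Nat using (ℕ; zero; suc; _+_; _≤_; _<_; z≤n; s≤s)
open import Data.Nat.Properties using (+-identityʳ; +-suc; +-cancelˡ-≤; ≤-reflexive)
open import Data.Fin using (Fin; toℕ; inject≤) renaming (zero to fzero; suc to fsuc)
open import Data.Fin.Properties using (_≟_; suc-injective; any?; toℕ-inject≤; inject≤-injective)
open import Data.Fin.Subset
  using (Subset; inside; outside; _∈_; _∉_; _∪_; _─_; _-_; ⁅_⁆; ⊤; ∣_∣; _⊆_)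
open import Data.Fin.Subset.Properties
  using (x∈⁅x⁆; x∈⁅y⁆⇒x≡y; ∣⊤∣≡n; ∪-identityʳ; p⊆p∪q; q⊆p∪q; x∈p∪q⁻;
         p─q⊆p; x∈p∧x≢y⇒x∈p-y; ⊆-antisym; ∈⊤)
open import Data.Vec using (_∷_; here; there)
import Data.Vec.Functional as Vector
open import Data.Product using (Σ; ∃; _×_; _,_)
open import Data.Sum using (inj₁; inj₂)
open import Data.Empty using (⊥-elim)
open import Function using (_∘_)
open import Relation.Nullary using (¬_; yes; no)
open import Relation.Binary.PropositionalEquality
  using (_≡_; _≢_; refl; sym; trans; cong; subst; subst₂; module ≡-Reasoning)
open import Relation.Binary.Construct.Closure.ReflexiveTransitive using (Star; ε; _◅_)

∣p∪⁅x⁆∣≡1+∣p∣ : ∀ {n} (p : Subset n) {x : Fin n} → x ∉ p → ∣ p ∪ ⁅ x ⁆ ∣ ≡ suc ∣ p ∣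
∣p∪⁅x⁆∣≡1+∣p∣ (inside  ∷ p) {fzero}  x∉p = ⊥-elim (x∉p here)
∣p∪⁅x⁆∣≡1+∣p∣ (outside ∷ p) {fzero}  x∉p = cong (suc ∘ ∣_∣) (∪-identityʳ p)
∣p∪⁅x⁆∣≡1+∣p∣ (inside  ∷ p) {fsuc x} x∉p = cong suc (∣p∪⁅x⁆∣≡1+∣p∣ p (x∉p ∘ there))
∣p∪⁅x⁆∣≡1+∣p∣ (outside ∷ p) {fsuc x} x∉p = ∣p∪⁅x⁆∣≡1+∣p∣ p (x∉p ∘ there)

x∈p─q⇒x∉q : ∀ {n} (p q : Subset n) {x : Fin n} → x ∈ p ─ q → x ∉ q
x∈p─q⇒x∉q (_ ∷ p) (inside ∷ q) ()         here
x∈p─q⇒x∉q (_ ∷ p) (_      ∷ q) (there x∈) (there x∈q) = x∈p─q⇒x∉q p q x∈ x∈q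

x∈p⇒p-x∪⁅x⁆≡p : ∀ {n} {p : Subset n} {x : Fin n} → x ∈ p → (p - x) ∪ ⁅ x ⁆ ≡ p
x∈p⇒p-x∪⁅x⁆≡p {p = p} {x} x∈p = ⊆-antisym ⊆p p⊆
  where
  ⊆p : (p - x) ∪ ⁅ x ⁆ ⊆ p
  ⊆p y∈ with x∈p∪q⁻ (p - x) ⁅ x ⁆ y∈
  ... | inj₁ y∈p-x = p─q⊆p p ⁅ x ⁆ y∈p-x
  ... | inj₂ y∈⁅x⁆ = subst (_∈ p) (sym (x∈⁅y⁆⇒x≡y x y∈⁅x⁆)) x∈p
  p⊆ : p ⊆ (p - x) ∪ ⁅ x ⁆
  p⊆ {y} y∈p with y ≟ x
  ... | yes refl = q⊆p∪q (p - x) ⁅ x ⁆ (x∈⁅x⁆ x)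
  ... | no  y≢x  = p⊆p∪q ⁅ x ⁆ (x∈p∧x≢y⇒x∈p-y y∈p y≢x)

∁image : ∀ {n k} → (Fin k → Fin n) → Subset n
∁image {k = zero}  t = ⊤
∁image {k = suc k} t = ∁image (t ∘ fsuc) - t fzero

∁image⁺ : ∀ {n k} {t : Fin k → Fin n} {x : Fin n} → (∀ j → t j ≢ x) → x ∈ ∁image t
∁image⁺ {k = zero}  _   = ∈⊤
∁image⁺ {k = suc k} t≢x = x∈p∧x≢y⇒x∈p-y (∁image⁺ (t≢x ∘ fsuc)) (t≢x fzero ∘ sym)

∉∁image⇒∈image : ∀ {n k} {t : Fin k → Fin n} {x : Fin n} → x ∉ ∁image t → ∃ λ j → t j ≡ x
∉∁image⇒∈image {t = t} {x} x∉ with any? (λ j → t j ≟ x)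
... | yes x∈image = x∈image
... | no  x∉image = ⊥-elim (x∉ (∁image⁺ (λ j e → x∉image (j , e))))

head∉∁image : ∀ {n k} (t : Fin (suc k) → Fin n) → t fzero ∉ ∁image t
head∉∁image t x∈ = x∈p─q⇒x∉q (∁image (t ∘ fsuc)) ⁅ t fzero ⁆ x∈ (x∈⁅x⁆ (t fzero))

module _ {n} (G : Graph n) where

  ∷-witness : ∀ {k} {s t : Fin k → Fin n} {u v : Fin n} → IsWitness G k s t →
              Adj G u v → (∀ j → ¬ Adj G u (t j)) →
              IsWitness G (suc k) (u Vector.∷ s) (v Vector.∷ t)
  ∷-witness {s = s} {t} {u} {v} (s-inj , s~t , s≁t) u~v u≁t = inj , adj , nonadj
    where
    u≢s : ∀ j → u ≢ s j
    u≢s j refl = u≁t j (s~t j)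
    inj : ∀ {i j} → (u Vector.∷ s) i ≡ (u Vector.∷ s) j → i ≡ j
    inj {fzero}  {fzero}  _ = refl
    inj {fzero}  {fsuc j} e = ⊥-elim (u≢s j e)
    inj {fsuc i} {fzero}  e = ⊥-elim (u≢s i (sym e))
    inj {fsuc i} {fsuc j} e = cong fsuc (s-inj e)
    adj : ∀ i → Adj G ((u Vector.∷ s) i) ((v Vector.∷ t) i)
    adj fzero    = u~v
    adj (fsuc i) = s~t i
    nonadj : ∀ i j → toℕ i < toℕ j → ¬ Adj G ((u Vector.∷ s) i) ((v Vector.∷ t) j)
    nonadj fzero    (fsuc j) _       = u≁t j
    nonadj (fsuc i) (fsuc j) (s≤s i<j) = s≁t i j i<j

  tail-witness : ∀ {k} {s t : Fin (suc k) → Fin n} → IsWitness G (suc k) s t →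
                 IsWitness G k (s ∘ fsuc) (t ∘ fsuc)
  tail-witness (s-inj , s~t , s≁t) =
    (λ e → suc-injective (s-inj e)) , s~t ∘ fsuc ,
    λ i j i<j → s≁t (fsuc i) (fsuc j) (s≤s i<j)

  prefix-witness : ∀ {k l} → k ≤ l → HasWitness G l → HasWitness G k
  prefix-witness k≤l (s , t , s-inj , s~t , s≁t) =
    s ∘ inj , t ∘ inj ,
    (λ {i} {j} e → inject≤-injective k≤l k≤l i j (s-inj e)) ,
    s~t ∘ inj ,
    λ i j i<j → s≁t (inj i) (inj j)
                  (subst₂ _<_ (sym (toℕ-inject≤ i k≤l)) (sym (toℕ-inject≤ j k≤l)) i<j)
    where
    inj : Fin _ → Fin _
    inj i = inject≤ i k≤l

  forcing⇒witness : ∀ {B} → ZeroForcingSet G B →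
                    ∃ λ l → ∣ B ∣ + l ≡ n × Σ (Fin l → Fin n) λ s → Σ (Fin l → Fin n) λ t →
                      IsWitness G l s t × (∀ j → t j ∉ B)
  forcing⇒witness ε =
    0 , trans (+-identityʳ _) (∣⊤∣≡n n) , (λ ()) , (λ ()) , ((λ { {()} }) , (λ ()) , (λ ())) , (λ ())
  forcing⇒witness {B} (force u v _ u~v v∉B unique ◅ rest) with forcing⇒witness rest
  ... | l , size , s , t , w , t∉B∪v =
    suc l , size′ , u Vector.∷ s , v Vector.∷ t , ∷-witness w u~v u≁t , v∷t∉B
    where
    t∉B : ∀ j → t j ∉ B
    t∉B j = t∉B∪v j ∘ p⊆p∪q ⁅ v ⁆
    -- t j is white when u fires, so u ~ t j would make it u's unique white neighbour v.
    u≁t : ∀ j → ¬ Adj G u (t j)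
    u≁t j u~tj =
      t∉B∪v j (subst (_∈ B ∪ ⁅ v ⁆) (sym (unique (t j) u~tj (t∉B j))) (q⊆p∪q B ⁅ v ⁆ (x∈⁅x⁆ v)))
    v∷t∉B : ∀ j → (v Vector.∷ t) j ∉ B
    v∷t∉B fzero    = v∉B
    v∷t∉B (fsuc j) = t∉B j
    size′ : ∣ B ∣ + suc l ≡ n
    size′ = trans (+-suc ∣ B ∣ l) (trans (cong (_+ l) (sym (∣p∪⁅x⁆∣≡1+∣p∣ B v∉B))) size)

  ∁image-forces-head : ∀ {k} {s t : Fin (suc k) → Fin n} → IsWitness G (suc k) s t →
                       (∀ j → s fzero ≢ t j) → ForceStep G (∁image t) (∁image t ∪ ⁅ t fzero ⁆)
  ∁image-forces-head {s = s} {t} (_ , s~t , s≁t) s≢t =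
    force _ _ (∁image⁺ (λ j e → s≢t j (sym e))) (s~t fzero) (head∉∁image t) unique
    where
    unique : ∀ w → Adj G (s fzero) w → w ∉ ∁image t → w ≡ t fzero
    unique w s~w w∉ with ∉∁image⇒∈image {t = t} w∉
    ... | fzero  , refl = refl
    ... | fsuc j , refl = ⊥-elim (s≁t fzero (fsuc j) (s≤s z≤n) s~w)

  witness⇒forcing : ∀ {k} {s t : Fin k → Fin n} → IsWitness G k s t → (∀ i j → s i ≢ t j) →
                    ZeroForcingSet G (∁image t) × ∣ ∁image t ∣ + k ≡ n
  witness⇒forcing {zero} _ _ = ε , trans (+-identityʳ _) (∣⊤∣≡n n)
  witness⇒forcing {suc k} {s} {t} w@(_ , s~t , s≁t) s≢t
    with witness⇒forcing (tail-witness w) (λ i j → s≢t (fsuc i) (fsuc j))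
  ... | forcing , size =
    ∁image-forces-head w (s≢t fzero) ◅ subst (λ B → Star (ForceStep G) B ⊤) (sym grow) forcing , size′
    where
    -- s₀ is adjacent to t₀ but to no later t_j, so t₀ is none of them.
    t₀∈ : t fzero ∈ ∁image (t ∘ fsuc)
    t₀∈ = ∁image⁺ (λ j e → s≁t fzero (fsuc j) (s≤s z≤n) (subst (Adj G (s fzero)) (sym e) (s~t fzero)))
    grow : ∁image t ∪ ⁅ t fzero ⁆ ≡ ∁image (t ∘ fsuc)
    grow = x∈p⇒p-x∪⁅x⁆≡p t₀∈
    open ≡-Reasoning
    size′ : ∣ ∁image t ∣ + suc k ≡ n
    size′ = begin
      ∣ ∁image t ∣ + suc k            ≡⟨ +-suc _ k ⟩
      suc ∣ ∁image t ∣ + k            ≡⟨ cong (_+ k) (∣p∪⁅x⁆∣≡1+∣p∣ (∁image t) (head∉∁image t)) ⟨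
      ∣ ∁image t ∪ ⁅ t fzero ⁆ ∣ + k  ≡⟨ cong (λ B → ∣ B ∣ + k) grow ⟩
      ∣ ∁image (t ∘ fsuc) ∣ + k       ≡⟨ size ⟩
      n                               ∎

lemma3p1 : ∀ (n : ℕ) (G : Graph n) (k : ℕ) →
    ((∃ λ (S : Subset n) → ZeroForcingSet G S × ∣ S ∣ + k ≤ n) → HasWitness G k)
    × ((s t : Fin k → Fin n) → IsWitness G k s t → (∀ i j → s i ≢ t j) →
       ∃ λ (S : Subset n) → ZeroForcingSet G S × ∣ S ∣ + k ≤ n)
lemma3p1 n G k = forcing⇒k-witness , k-witness⇒forcing
  where
  forcing⇒k-witness : (∃ λ (S : Subset n) → ZeroForcingSet G S × ∣ S ∣ + k ≤ n) → HasWitness G k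
  forcing⇒k-witness (S , zf , ∣S∣+k≤n) with forcing⇒witness G zf
  ... | l , ∣S∣+l≡n , s , t , w , _ =
    prefix-witness G (+-cancelˡ-≤ ∣ S ∣ k l (subst (∣ S ∣ + k ≤_) (sym ∣S∣+l≡n) ∣S∣+k≤n)) (s , t , w)
  k-witness⇒forcing : (s t : Fin k → Fin n) → IsWitness G k s t → (∀ i j → s i ≢ t j) →
                      ∃ λ (S : Subset n) → ZeroForcingSet G S × ∣ S ∣ + k ≤ n
  k-witness⇒forcing s t w s≢t with witness⇒forcing G w s≢t
  ... | zf , size = ∁image t , zf , ≤-reflexive size
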